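{- Every directed path $P$ satisfies $\dim(P)\le 4$, and there exist directed paths $P$ with $\dim(P)=4$.
   Context: All digraphs are finite and have simple underlying graphs. A directed path is a digraph $v_1\to v_2\to\cdots\to v_m$ with vertex set $\{v_1,\dots,v_m\}$ and arc set exactly $\{(v_i,v_{i+1}):1\le i<m\}$. For an integer $d\ge 0$ write $[d]=\{1,\dots,d\}$ (with $\mathbb{R}^0=\{0\}$). For $x,y\in\mathbb{R}^d$ let $\mathcal{G}_{x>y}=\{i\in[d]: x_i>y_i\}$. The weak majority relation: $x\succ y$ iff $|\mathcal{G}_{x>y}|-|\mathcal{G}_{y>x}|>0$. A map $f:V(D)\to\mathbb{R}^d$ is an $\mathbb{R}^d$-realizer of $D$ if for all vertices $x,y$: $(x,y)\in A(D)$ iff $f(x)\succ f(y)$. The weak majority dimension $\dim(D)$ is the minimum nonnegative integer $d$ such that $D$ has an $\mathbb{R}^d$-realizer (such $d$ always exists).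
   Formalization: Realizers of a digraph take values in ℚ^d in place of $\mathbb{R}^d$. -}

module Defs where

open import Data.Nat using (ℕ; zero; suc; _+_; _<_; _≤_)
open import Data.Fin using (Fin; toℕ)
import Data.Fin as F
open import Data.Rational using (ℚ)
import Data.Rational as Q
open import Data.Rational.Properties using (_<?_)
open import Data.Product using (Σ; _×_; ∃)
open import Data.Bool using (Bool; true; false)
open import Relation.Nullary using (¬_)
open import Relation.Nullary.Decidable using (⌊_⌋)
open import Relation.Binary.PropositionalEquality using (_≡_)
open import Function.Bundles using (_↔_; _⇔_; Inverse)

record Digraph : Set₁ where
  field
    n   : ℕ
    Arc : Fin n → Fin n → Set
open Digraph public

-- Points of ℝ^d are modelled as points of ℚ^d.
Point : ℕ → Set
Point d = Fin d → ℚ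

count : (d : ℕ) → (Fin d → Bool) → ℕ
count zero    p = 0
count (suc d) p with p F.zero
... | true  = suc (count d (λ i → p (F.suc i)))
... | false = count d (λ i → p (F.suc i))

G> : {d : ℕ} → Point d → Point d → ℕ
G> {d} x y = count d (λ i → ⌊ y i <? x i ⌋)

_≻_ : {d : ℕ} → Point d → Point d → Set
x ≻ y = G> y x < G> x y

IsRealizer : (D : Digraph) (d : ℕ) → (Fin (n D) → Point d) → Set
IsRealizer D d f = ∀ x y → Arc D x y ⇔ (f x ≻ f y)

HasRealizer : Digraph → ℕ → Set
HasRealizer D d = Σ (Fin (n D) → Point d) (IsRealizer D d)

DimLe : Digraph → ℕ → Set
DimLe D k = Σ ℕ (λ d → d ≤ k × HasRealizer D d)

DimEq : Digraph → ℕ → Set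
DimEq D k = HasRealizer D k × (∀ d → d < k → ¬ HasRealizer D d)

-- D is a directed path v_1 → ... → v_m: there is a bijection σ from the
-- vertices onto Fin m (σ x = position of x) with arcs exactly (v_i, v_{i+1}).
IsDirectedPath : Digraph → Set
IsDirectedPath D =
  Σ (Fin (n D) ↔ Fin (n D)) λ σ →
    ∀ x y → Arc D x y ⇔ (toℕ (Inverse.to σ y) ≡ suc (toℕ (Inverse.to σ x)))

{-# OPTIONS --safe #-}
module Submission where

-- Upper bound: send the i-th vertex of the path to (−i−1, ⌊i/2⌋, ⌈i/2⌉, −i−1).
-- For i < j the earlier point wins both descending coordinates; the later one
-- wins both halving coordinates when j ≥ i + 2 (a tie, so no arc) but exactly
-- one of them when j = i + 1 (so an arc i → i+1).
--
-- Lower bound: a realizer of the path on six vertices in ℚ³ orders the vertices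
-- weakly in each coordinate. The resulting comparisons are transitive within each
-- coordinate, and for every pair their majority reproduces the arcs. A backtracking
-- search over such comparison profiles, evaluated by the type checker, finds none.
-- Smaller dimensions reduce to three by adding constant coordinates.

open import Defs
open import Data.Bool using (Bool; true; false; T; _∧_; if_then_else_)
open import Data.Bool.ListAction using (all; any)
import Data.Bool.Properties as Boolₚ
open import Data.Fin using (Fin; toℕ; zero; suc)
import Data.Fin.Properties as Finₚ
open import Data.Integer using (ℤ; +_; -[1+_]; +<+; -<-)
import Data.Integer as ℤ
import Data.Integer.Properties as ℤₚ
open import Data.List using (List; []; _∷_; map; concatMap; filterᵇ; allFin)
open import Data.List.Membership.Propositional using (_∈_; lose)
open import Data.List.Relation.Unary.Any using (here; there)
open import Data.List.Relation.Unary.Any.Properties using (any⁺)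
import Data.List.Relation.Unary.All as All
open import Data.List.Relation.Unary.All.Properties using (all⁻)
open import Data.Maybe using (Maybe; just; nothing; maybe′; _>>=_)
open import Data.Maybe.Relation.Unary.All using (just; nothing) renaming (All to AllMaybe)
open import Data.Nat using (ℕ; zero; suc; _<_; _≤′_; ≤′-refl; ≤′-step; _<ᵇ_; ⌊_/2⌋; ⌈_/2⌉; s≤s; z≤n)
import Data.Nat as ℕ
open import Data.Nat.Properties using (≤-refl; ≤-pred; ≤⇒≤′; suc-injective; <ᵇ-reflects-<; n≮n)
open import Data.Nat.Coprimality using (1-coprimeTo)
import Data.Nat.Coprimality as Coprimality
open import Data.Product using (Σ; _×_; _,_)
open import Data.Product.Properties using (≡-dec)
open import Data.Rational using (ℚ; mkℚ; 0ℚ; *<*)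
import Data.Rational as ℚ
open import Data.Rational.Properties using (_<?_; <-cmp; <-trans)
import Data.Vec.Functional as Vector
open import Function using (_∘_; id)
open import Function.Bundles using (_⇔_; mk⇔; Equivalence; Inverse)
open import Function.Construct.Composition using (_⇔-∘_)
open import Function.Construct.Identity using (↔-id)
open import Relation.Binary.Definitions using (tri<; tri≈; tri>; DecidableEquality; Decidable)
open import Relation.Binary.PropositionalEquality using (_≡_; refl; sym; trans; cong; cong₂; subst; subst₂)
open import Relation.Nullary using (¬_; Dec; yes; no; does; _because_; contradiction)
open import Relation.Nullary.Decidable using (⌊_⌋; isYes≗does; dec-true; dec-false; does-⇔; fromWitness)

data Comparison : Set where
  lt eq gt : Comparison

comparisons : List Comparison
comparisons = lt ∷ eq ∷ gt ∷ []

∈-comparisons : ∀ o → o ∈ comparisons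
∈-comparisons lt = here refl
∈-comparisons eq = there (here refl)
∈-comparisons gt = there (there (here refl))

_==_ : Comparison → Comparison → Bool
lt == lt = true
eq == eq = true
gt == gt = true
_  == _  = false

==-refl : ∀ o → T (o == o)
==-refl lt = _
==-refl eq = _
==-refl gt = _

Holds : Comparison → ℚ → ℚ → Set
Holds lt a b = a ℚ.< b
Holds eq a b = a ≡ b
Holds gt a b = b ℚ.< a

compare : ℚ → ℚ → Comparison
compare a b with <-cmp a b
... | tri< _ _ _ = lt
... | tri≈ _ _ _ = eq
... | tri> _ _ _ = gt

compare-holds : ∀ a b → Holds (compare a b) a b
compare-holds a b with <-cmp a b
... | tri< a<b _ _ = a<b
... | tri≈ _ a≡b _ = a≡b
... | tri> _ _ b<a = b<a

compare-unique : ∀ o {a b} → Holds o a b → compare a b ≡ o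
compare-unique o {a} {b} h with <-cmp a b
compare-unique lt h | tri< _ _ _   = refl
compare-unique eq h | tri≈ _ _ _   = refl
compare-unique gt h | tri> _ _ _   = refl
compare-unique lt h | tri≈ a≮b _ _ = contradiction h a≮b
compare-unique lt h | tri> a≮b _ _ = contradiction h a≮b
compare-unique eq h | tri< _ a≢b _ = contradiction h a≢b
compare-unique eq h | tri> _ a≢b _ = contradiction h a≢b
compare-unique gt h | tri< _ _ b≮a = contradiction h b≮a
compare-unique gt h | tri≈ _ _ b≮a = contradiction h b≮a

<?-compare : ∀ a b → does (a <? b) ≡ lt == compare a b
<?-compare a b with <-cmp a b
... | tri< a<b _ _ = dec-true  (a <? b) a<b
... | tri≈ a≮b _ _ = dec-false (a <? b) a≮b
... | tri> a≮b _ _ = dec-false (a <? b) a≮b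

>?-compare : ∀ a b → does (b <? a) ≡ gt == compare a b
>?-compare a b with <-cmp a b
... | tri< _ _ b≮a = dec-false (b <? a) b≮a
... | tri≈ _ _ b≮a = dec-false (b <? a) b≮a
... | tri> _ _ b<a = dec-true  (b <? a) b<a

_⨾_ : Comparison → Comparison → Maybe Comparison
lt ⨾ lt = just lt
lt ⨾ eq = just lt
lt ⨾ gt = nothing
eq ⨾ o  = just o
gt ⨾ lt = nothing
gt ⨾ eq = just gt
gt ⨾ gt = just gt

Holds-⨾ : ∀ {o₁ o₂ o a b c} → o₁ ⨾ o₂ ≡ just o → Holds o₁ a b → Holds o₂ b c → Holds o a c
Holds-⨾ {lt} {lt} refl a<b b<c  = <-trans a<b b<c
Holds-⨾ {lt} {eq} refl a<b refl = a<b
Holds-⨾ {eq} {_}  refl refl b~c = b~c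
Holds-⨾ {gt} {eq} refl b<a refl = b<a
Holds-⨾ {gt} {gt} refl b<a c<b  = <-trans c<b b<a

consistent : Comparison → Comparison → Comparison → Bool
consistent o₁ o₂ o₃ = maybe′ (_== o₃) true (o₁ ⨾ o₂)

compare-consistent : ∀ a b c → T (consistent (compare a b) (compare b c) (compare a c))
compare-consistent a b c with compare a b ⨾ compare b c in forced
... | nothing = _
... | just o rewrite compare-unique o (Holds-⨾ forced (compare-holds a b) (compare-holds b c)) = ==-refl o

count-cong : ∀ {d} {p q : Fin d → Bool} → (∀ i → p i ≡ q i) → count d p ≡ count d q
count-cong {zero}  p≗q = refl
count-cong {suc d} {p} {q} p≗q with p zero | q zero | p≗q zero
... | true  | true  | refl = cong suc (count-cong (p≗q ∘ suc))
... | false | false | refl = count-cong (p≗q ∘ suc)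

G>≡count-does : ∀ {d} (p q : Point d) → G> p q ≡ count d (λ i → does (q i <? p i))
G>≡count-does p q = count-cong λ i → isYes≗does (q i <? p i)

tally : ∀ {d} → Comparison → (Fin d → Comparison) → ℕ
tally {d} o g = count d (λ i → o == g i)

module _ {d} {p q : Point d} {g : Fin d → Comparison} (g≗ : ∀ i → g i ≡ compare (p i) (q i)) where

  G>≡tally-gt : G> p q ≡ tally gt g
  G>≡tally-gt = trans (G>≡count-does p q)
    (count-cong λ i → trans (>?-compare (p i) (q i)) (cong (gt ==_) (sym (g≗ i))))

  G>≡tally-lt : G> q p ≡ tally lt g
  G>≡tally-lt = trans (G>≡count-does q p)
    (count-cong λ i → trans (<?-compare (p i) (q i)) (cong (lt ==_) (sym (g≗ i))))

-- A constant coordinate is never won, so every G> is unchanged definitionally.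
HasRealizer-suc : ∀ {D d} → HasRealizer D d → HasRealizer D (suc d)
HasRealizer-suc (f , realizes) = (λ x → 0ℚ Vector.∷ f x) , realizes

HasRealizer-mono : ∀ {D d e} → d ≤′ e → HasRealizer D d → HasRealizer D e
HasRealizer-mono ≤′-refl        = id
HasRealizer-mono (≤′-step d≤′e) = HasRealizer-suc ∘ HasRealizer-mono d≤′e

sequenceᶠ : ∀ {A : Set} {m} → (Fin m → Maybe A) → Maybe (Fin m → A)
sequenceᶠ {m = zero}  h = just Vector.[]
sequenceᶠ {m = suc m} h = h zero >>= λ a → sequenceᶠ (h ∘ suc) >>= λ g → just (a Vector.∷ g)

sequenceᶠ-All : ∀ {A : Set} {m} {h : Fin m → Maybe A} {g : Fin m → A} →
                (∀ i → AllMaybe (_≡ g i) (h i)) → AllMaybe (λ g′ → ∀ i → g′ i ≡ g i) (sequenceᶠ h)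
sequenceᶠ-All {m = zero} _ = just λ ()
sequenceᶠ-All {m = suc m} {h} h≈g with h zero | h≈g zero
... | nothing | nothing = nothing
... | just a  | just a≡ with sequenceᶠ (h ∘ suc) | sequenceᶠ-All (h≈g ∘ suc)
...   | nothing | nothing  = nothing
...   | just g′ | just g′≗ = just λ { zero → a≡ ; (suc i) → g′≗ i }

sameAnswer : ∀ {A B : Set} → Dec A → Dec B → Bool
sameAnswer a? b? = ⌊ does a? Boolₚ.≟ does b? ⌋

sameAnswer-⇔ : ∀ {A B : Set} → A ⇔ B → (a? : Dec A) (b? : Dec B) → T (sameAnswer a? b?)
sameAnswer-⇔ A⇔B a? b? = fromWitness (does-⇔ A⇔B a? b?)

module Search (D : Digraph) (arc? : Decidable (Arc D)) (d : ℕ) where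

  Key : Set
  Key = Fin (n D) × Fin (n D) × Fin d

  _≟ᴷ_ : DecidableEquality Key
  _≟ᴷ_ = ≡-dec Finₚ._≟_ (≡-dec Finₚ._≟_ Finₚ._≟_)

  Assignment : Set
  Assignment = Key → Maybe Comparison

  ∅ : Assignment
  ∅ _ = nothing

  _[_≔_] : Assignment → Key → Comparison → Assignment
  (σ [ v ≔ o ]) w = if does (w ≟ᴷ v) then just o else σ w

  data Constraint : Set where
    majority   : Fin (n D) → Fin (n D) → Constraint
    transitive : Fin d → Fin (n D) → Fin (n D) → Fin (n D) → Constraint

  majorityAgrees : Fin (n D) → Fin (n D) → (Fin d → Comparison) → Bool
  majorityAgrees x y g = sameAnswer (arc? x y) (tally lt g ℕ.<? tally gt g)
                       ∧ sameAnswer (arc? y x) (tally gt g ℕ.<? tally lt g)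

  consistent? : Maybe Comparison → Maybe Comparison → Maybe Comparison → Bool
  consistent? (just o₁) (just o₂) (just o₃) = consistent o₁ o₂ o₃
  consistent? _         _         _         = true

  check : Assignment → Constraint → Bool
  check σ (majority x y)       = maybe′ (majorityAgrees x y) true (sequenceᶠ λ k → σ (x , y , k))
  check σ (transitive k x y z) = consistent? (σ (x , y , k)) (σ (y , z , k)) (σ (x , z , k))

  Schedule : Set
  Schedule = List (Key × List Constraint)

  mutual
    search : Schedule → Assignment → Bool
    search []               σ = true
    search ((v , cs) ∷ sch) σ = any (survives cs sch ∘ σ [ v ≔_]) comparisons

    survives : List Constraint → Schedule → Assignment → Bool
    survives cs sch σ = all (check σ) cs ∧ search sch σ

  -- Correctness does not depend on the schedule, only efficiency does: pairs x < y
  -- come in increasing order of y, so each constraint is checked as soon as the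
  -- last of its variables is assigned.
  schedule : Schedule
  schedule = concatMap (λ y → concatMap (λ x → map (entry x y) (allFin d)) (below y)) (allFin (n D))
    where
    below : Fin (n D) → List (Fin (n D))
    below y = filterᵇ (λ x → toℕ x <ᵇ toℕ y) (allFin (n D))

    entry : Fin (n D) → Fin (n D) → Fin d → Key × List Constraint
    entry x y k = (x , y , k) , majority x y ∷ map (λ w → transitive k w x y) (below x)

  module _ (f : Fin (n D) → Point d) (realizes : IsRealizer D d f) where

    ρ : Key → Comparison
    ρ (x , y , k) = compare (f x k) (f y k)

    Agrees : Assignment → Set
    Agrees σ = ∀ v → AllMaybe (_≡ ρ v) (σ v)

    ∅-agrees : Agrees ∅
    ∅-agrees _ = nothing

    [≔]-agrees : ∀ {σ} → Agrees σ → ∀ v → Agrees (σ [ v ≔ ρ v ])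
    [≔]-agrees σ≈ρ v w with w ≟ᴷ v
    ... | yes refl = just refl
    ... | no  _    = σ≈ρ w

    majorityAgrees-ρ : ∀ x y {g} → (∀ k → g k ≡ ρ (x , y , k)) → T (majorityAgrees x y g)
    majorityAgrees-ρ x y g≗ = Equivalence.from Boolₚ.T-∧
      ( sameAnswer-⇔ (subst (Arc D x y ⇔_) (cong₂ _<_ (G>≡tally-lt g≗) (G>≡tally-gt g≗)) (realizes x y))
                     (arc? x y) (_ ℕ.<? _)
      , sameAnswer-⇔ (subst (Arc D y x ⇔_) (cong₂ _<_ (G>≡tally-gt g≗) (G>≡tally-lt g≗)) (realizes y x))
                     (arc? y x) (_ ℕ.<? _) )

    consistent?-ρ : ∀ {m₁ m₂ m₃ a b c} → AllMaybe (_≡ compare a b) m₁ → AllMaybe (_≡ compare b c) m₂ →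
                    AllMaybe (_≡ compare a c) m₃ → T (consistent? m₁ m₂ m₃)
    consistent?-ρ nothing     _           _           = _
    consistent?-ρ (just refl) nothing     _           = _
    consistent?-ρ (just refl) (just refl) nothing     = _
    consistent?-ρ {a = a} {b} {c} (just refl) (just refl) (just refl) = compare-consistent a b c

    check-ρ : ∀ {σ} → Agrees σ → ∀ c → T (check σ c)
    check-ρ {σ} σ≈ρ (majority x y)
      with sequenceᶠ (λ k → σ (x , y , k)) | sequenceᶠ-All (λ k → σ≈ρ (x , y , k))
    ... | nothing | nothing = _
    ... | just g  | just g≗ = majorityAgrees-ρ x y g≗
    check-ρ σ≈ρ (transitive k x y z) = consistent?-ρ (σ≈ρ _) (σ≈ρ _) (σ≈ρ _)

    search-ρ : ∀ sch {σ} → Agrees σ → T (search sch σ)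
    search-ρ []               _   = _
    search-ρ ((v , cs) ∷ sch) {σ} σ≈ρ =
      any⁺ (survives cs sch ∘ σ [ v ≔_]) (lose (∈-comparisons (ρ v)) (Equivalence.from Boolₚ.T-∧
        (all⁻ _ (All.universal (check-ρ σ≈ρ′) cs) , search-ρ sch σ≈ρ′)))
      where σ≈ρ′ = [≔]-agrees σ≈ρ v

  HasRealizer⇒search : HasRealizer D d → ∀ sch → T (search sch ∅)
  HasRealizer⇒search (f , realizes) sch = search-ρ f realizes sch (∅-agrees f realizes)

path : ℕ → Digraph
path m = record { n = m ; Arc = λ x y → toℕ y ≡ suc (toℕ x) }

path-isDirectedPath : ∀ m → IsDirectedPath (path m)
path-isDirectedPath m = ↔-id (Fin m) , λ x y → mk⇔ id id

path-arc? : ∀ m → Decidable (Arc (path m))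
path-arc? m x y = toℕ y ℕ.≟ suc (toℕ x)

module Path6 = Search (path 6) (path-arc? 6) 3

-- The type checker evaluates the search to false, and T false is ⊥.
path6-noRealizer3 : ¬ HasRealizer (path 6) 3
path6-noRealizer3 h = Path6.HasRealizer⇒search h Path6.schedule

path6-noRealizer : ∀ d → d < 4 → ¬ HasRealizer (path 6) d
path6-noRealizer d d<4 = path6-noRealizer3 ∘ HasRealizer-mono (≤⇒≤′ (≤-pred d<4))

ι : ℤ → ℚ
ι z = mkℚ z 0 (Coprimality.sym (1-coprimeTo _))

ι-<-⇔ : ∀ {a b} → ι a ℚ.< ι b ⇔ a ℤ.< b
ι-<-⇔ {a} {b} = mk⇔ (λ { (*<* a<b) → subst₂ ℤ._<_ (ℤₚ.*-identityʳ a) (ℤₚ.*-identityʳ b) a<b })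
                    (λ a<b → *<* (subst₂ ℤ._<_ (sym (ℤₚ.*-identityʳ a)) (sym (ℤₚ.*-identityʳ b)) a<b))

<ᵇ-dec : ∀ m n → Dec (m < n)
<ᵇ-dec m n = m <ᵇ n because <ᵇ-reflects-< m n

<?-ι+ : ∀ a b → does (ι (+ a) <? ι (+ b)) ≡ (a <ᵇ b)
<?-ι+ a b = does-⇔ (mk⇔ (ℤₚ.drop‿+<+ ∘ Equivalence.to ι-<-⇔) (Equivalence.from ι-<-⇔ ∘ +<+))
                   (ι (+ a) <? ι (+ b)) (<ᵇ-dec a b)

<?-ι- : ∀ a b → does (ι -[1+ a ] <? ι -[1+ b ]) ≡ (b <ᵇ a)
<?-ι- a b = does-⇔ (mk⇔ (ℤₚ.drop‿-<- ∘ Equivalence.to ι-<-⇔) (Equivalence.from ι-<-⇔ ∘ -<-))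
                   (ι -[1+ a ] <? ι -[1+ b ]) (<ᵇ-dec b a)

pathPoint : ℕ → Point 4
pathPoint i zero                   = ι -[1+ i ]
pathPoint i (suc zero)             = ι (+ ⌊ i /2⌋)
pathPoint i (suc (suc zero))       = ι (+ ⌈ i /2⌉)
pathPoint i (suc (suc (suc zero))) = ι -[1+ i ]

beats : ℕ → ℕ → Fin 4 → Bool
beats i j zero                   = i <ᵇ j
beats i j (suc zero)             = ⌊ j /2⌋ <ᵇ ⌊ i /2⌋
beats i j (suc (suc zero))       = ⌈ j /2⌉ <ᵇ ⌈ i /2⌉
beats i j (suc (suc (suc zero))) = i <ᵇ j

wins : ℕ → ℕ → ℕ
wins i j = count 4 (beats i j)

G>-pathPoint : ∀ i j → G> (pathPoint i) (pathPoint j) ≡ wins i j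
G>-pathPoint i j = trans (G>≡count-does (pathPoint i) (pathPoint j))
  (count-cong {p = λ k → does (pathPoint j k <? pathPoint i k)} {beats i j} λ where
    zero                   → <?-ι- j i
    (suc zero)             → <?-ι+ ⌊ j /2⌋ ⌊ i /2⌋
    (suc (suc zero))       → <?-ι+ ⌈ j /2⌉ ⌈ i /2⌉
    (suc (suc (suc zero))) → <?-ι- j i)

wins-+2 : ∀ i j → wins (suc (suc i)) (suc (suc j)) ≡ wins i j
wins-+2 i j = count-cong {p = beats (suc (suc i)) (suc (suc j))} {beats i j} λ where
  zero                   → refl
  (suc zero)             → refl
  (suc (suc zero))       → refl
  (suc (suc (suc zero))) → refl

wins-path : ∀ i j → (j ≡ suc i) ⇔ (wins j i < wins i j)
wins-path (suc (suc i)) (suc (suc j)) rewrite wins-+2 i j | wins-+2 j i =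
  mk⇔ (Equivalence.to (wins-path i j) ∘ suc-injective ∘ suc-injective)
      (cong (2 ℕ.+_) ∘ Equivalence.from (wins-path i j))
wins-path 0 0                     = mk⇔ (λ ()) (λ ())
wins-path 0 1                     = mk⇔ (λ _ → s≤s (s≤s z≤n)) (λ _ → refl)
wins-path 0 (suc (suc j))         = mk⇔ (λ ()) (λ h → contradiction h (n≮n 2))
wins-path 1 0                     = mk⇔ (λ ()) (λ { (s≤s ()) })
wins-path 1 1                     = mk⇔ (λ ()) (λ ())
wins-path 1 2                     = mk⇔ (λ _ → s≤s (s≤s z≤n)) (λ _ → refl)
wins-path 1 (suc (suc (suc j)))   = mk⇔ (λ ()) (λ h → contradiction h (n≮n 2))
wins-path (suc (suc i)) 0         = mk⇔ (λ ()) (λ h → contradiction h (n≮n 2))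
wins-path 2 1                     = mk⇔ (λ ()) (λ { (s≤s ()) })
wins-path (suc (suc (suc i))) 1   = mk⇔ (λ ()) (λ h → contradiction h (n≮n 2))

pathPoint-≻ : ∀ i j → (j ≡ suc i) ⇔ (pathPoint i ≻ pathPoint j)
pathPoint-≻ i j =
  subst ((j ≡ suc i) ⇔_) (sym (cong₂ _<_ (G>-pathPoint j i) (G>-pathPoint i j))) (wins-path i j)

directedPath-realizer : ∀ P → IsDirectedPath P → HasRealizer P 4
directedPath-realizer P (σ , arc⇔) =
  pathPoint ∘ position , λ x y → pathPoint-≻ (position x) (position y) ⇔-∘ arc⇔ x y
  where
  position : Fin (n P) → ℕ
  position = toℕ ∘ Inverse.to σ

theorem4p3 : ((P : Digraph) → IsDirectedPath P → DimLe P 4)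
    × Σ Digraph (λ P → IsDirectedPath P × DimEq P 4)
theorem4p3 =
    (λ P isPath → 4 , ≤-refl , directedPath-realizer P isPath)
  , path 6 , path-isDirectedPath 6 , directedPath-realizer (path 6) (path-isDirectedPath 6) , path6-noRealizer
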